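{- Let $\mathcal{F}(t,s)=1+\sum_{n\ge k\ge 1}N_{n,k}t^ns^k\in\mathrm{Sym}[[t,s]]$ and $P(t)=\sum_{j\ge1}p_jt^{j-1}$. Then \[ t\frac{\partial\mathcal{F}}{\partial t}(t,s)+(1-s)\frac{\partial\mathcal{F}}{\partial s}(t,s)=tP(t)\mathcal{F}(t,s). \]
   Context: $\mathrm{Sym}$ is the algebra of symmetric functions, viewed as the subring of $\mathbb{Q}[[x_1,x_2,\dots]]$ of bounded-degree formal power series invariant under permutations of the variables. $p_j=\sum_i x_i^j$ is the power-sum symmetric function. For $n\ge k\ge1$, $N_{n,k}$ is the sum of all monomial symmetric functions $m_\lambda$ over partitions $\lambda$ of $n$ having exactly $k$ parts. -}

module Defs where

open import Data.Nat as ℕ using (ℕ; zero; suc; _∸_; _⊓_; _≤?_)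
open import Data.Nat.Properties as ℕP using (≤-decTotalOrder)
open import Data.Integer using (+_)
open import Data.Rational using (ℚ; 0ℚ; 1ℚ; _+_; _*_; -_; _/_)
open import Data.List as L using (List; []; _∷_; concatMap; applyUpTo; filterᵇ; allFin; foldr)
import Data.List.Properties as LP
open import Data.Vec as V using (Vec; []; _∷_; tabulate; replicate; toList)
import Data.Vec.Properties as VP
open import Data.Fin as F using (Fin)
import Data.Fin.Properties as FP
open import Relation.Nullary.Decidable using (does)
open import Data.Bool using (Bool; true; false; if_then_else_; not)

Σ≤ : ℕ → (ℕ → ℚ) → ℚ
Σ≤ zero    f = f zero
Σ≤ (suc n) f = Σ≤ n f + f (suc n)

ΣFin : (m : ℕ) → (Fin m → ℚ) → ℚ
ΣFin m f = foldr _+_ 0ℚ (L.map f (allFin m))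

ℕ→ℚ : ℕ → ℚ
ℕ→ℚ n = (+ n) / 1

-- Formal power series in the variables x_1, …, x_m over ℚ, given by
-- their coefficient functions: an exponent vector α ∈ ℕ^m stands for
-- the monomial x^α = x_1^{α_1} ⋯ x_m^{α_m}.
-- An element of Sym ⊆ ℚ[[x_1,x_2,…]] is determined by its images under
-- all the specialisations x_{m+1} = x_{m+2} = ⋯ = 0 (m ∈ ℕ), so an
-- identity in Sym is stated as an identity in ℚ[[x_1,…,x_m]] for all m.

Coef : ℕ → Set
Coef m = Vec ℕ m → ℚ

zeroC : ∀ {m} → Coef m
zeroC _ = 0ℚ

oneC : ∀ {m} → Coef m
oneC α = if does (VP.≡-dec ℕ._≟_ α (replicate _ 0)) then 1ℚ else 0ℚ

_+C_ : ∀ {m} → Coef m → Coef m → Coef m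
(f +C g) α = f α + g α

-- product of power series: (f g)_α = Σ_{β + γ = α} f_β g_γ
_*C_ : ∀ {m} → Coef m → Coef m → Coef m
_*C_ {zero}  f g []      = f [] * g []
_*C_ {suc m} f g (a ∷ α) =
  Σ≤ a (λ i → _*C_ {m} (λ β → f (i ∷ β)) (λ γ → g ((a ∸ i) ∷ γ)) α)

_·C_ : ∀ {m} → ℚ → Coef m → Coef m
(c ·C f) α = c * f α

-- power sum p_j = Σ_i x_i^j  (coefficient of x^α is the number of i with α = j·e_i)
unitVec : ∀ {m} → Fin m → ℕ → Vec ℕ m
unitVec i j = tabulate (λ l → if does (l F.≟ i) then j else 0)

p : ∀ {m} → ℕ → Coef m
p {m} j α = ΣFin m (λ i → if does (VP.≡-dec ℕ._≟_ α (unitVec i j)) then 1ℚ else 0ℚ)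

-- A partition is a weakly decreasing list of positive integers.
-- partitionsBounded n k b : all partitions of n with exactly k parts,
-- each part ≤ b (listed once each).
partitionsBounded : ℕ → ℕ → ℕ → List (List ℕ)
partitionsBounded zero    zero    b = [] ∷ []
partitionsBounded (suc n) zero    b = []
partitionsBounded n       (suc k) b =
  concatMap (λ i → L.map (i ∷_) (partitionsBounded (n ∸ i) k i))
            (applyUpTo suc (b ⊓ n))

partitions : ℕ → ℕ → List (List ℕ)
partitions n k = partitionsBounded n k n

insert : ℕ → List ℕ → List ℕ
insert x []       = x ∷ []
insert x (y ∷ ys) = if does (x ≤? y) then x ∷ y ∷ ys else y ∷ insert x ys

sort : List ℕ → List ℕ
sort []       = []
sort (x ∷ xs) = insert x (sort xs)

-- monomial symmetric function m_λ: the coefficient of x^α is 1 if the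
-- nonzero entries of α are a rearrangement of the parts of λ, else 0
mono : ∀ {m} → List ℕ → Coef m
mono λ′ α =
  if does (LP.≡-dec ℕ._≟_ (sort (filterᵇ (λ a → not (does (a ℕ.≟ 0))) (toList α)))
                          (sort λ′))
  then 1ℚ else 0ℚ

N : ∀ {m} → ℕ → ℕ → Coef m
N n k = foldr _+C_ zeroC (L.map mono (partitions n k))

-- Formal power series in t, s with coefficients in ℚ[[x_1..x_m]]:
-- S n k is the coefficient of t^n s^k.

Ser : ℕ → Set
Ser m = ℕ → ℕ → Coef m

_+S_ : ∀ {m} → Ser m → Ser m → Ser m
(F +S G) n k = F n k +C G n k

_*S_ : ∀ {m} → Ser m → Ser m → Ser m
(F *S G) n k = λ α → Σ≤ n (λ a → Σ≤ k (λ b → (F a b *C G (n ∸ a) (k ∸ b)) α))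

∂t : ∀ {m} → Ser m → Ser m
∂t F n k = ℕ→ℚ (suc n) ·C F (suc n) k

∂s : ∀ {m} → Ser m → Ser m
∂s F n k = ℕ→ℚ (suc k) ·C F n (suc k)

tS : ∀ {m} → Ser m
tS 1 0 = oneC
tS _ _ = zeroC

oneMinusS : ∀ {m} → Ser m
oneMinusS 0 0 = oneC
oneMinusS 0 1 = λ α → - oneC α
oneMinusS _ _ = zeroC

𝓕 : ∀ {m} → Ser m
𝓕 zero    zero    = oneC
𝓕 (suc n) zero    = zeroC
𝓕 n       (suc k) = if does (suc k ≤? n) then N n (suc k) else zeroC

P : ∀ {m} → Ser m
P n zero    = p (suc n)
P n (suc k) = zeroC

module Submission where

-- Write |α| for the weight α₁ + ⋯ + α_m of an exponent vector and ℓ(α) for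
-- its number of nonzero entries.  The heart of the proof is that the
-- coefficient of x^α t^n s^k in 𝓕 is the indicator [|α| = n][ℓ(α) = k]:
-- N_{n,k} is the sum of all monomials of degree n involving exactly k
-- variables (𝓕-coef, via the enumeration of partitions).  Consequently the
-- left-hand side has coefficient [|α| = n]((n − k)[ℓ = k] + (k+1)[ℓ = k+1]).
-- On the right-hand side, t P(t) 𝓕 has coefficient Σ_{j=1}^{n} (p_j · 𝓕_{n−j,k})_α,
-- and multiplying an indicator of this kind by p_j = Σ_i x_i^j counts the
-- entries α_i > j (the variable x_i stays) and the entries α_i = j (a new
-- variable appears) (p*shape).  Summing over j, the first counts add up to
-- |α| − ℓ(α) and the second to ℓ(α), which gives the same coefficient.

open import Defs
open import Data.Nat using (ℕ)
open import Data.Vec using (Vec)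
open import Relation.Binary.PropositionalEquality using (_≡_)

open import Data.Nat as ℕ using (zero; suc; _∸_; _≤_; _<_; z≤n; s≤s; _⊓_)
import Data.Nat.Properties as NP
open import Data.Nat.ListAction using (sum)
import Data.Nat.ListAction.Properties as NLP
import Data.Integer as ℤ
import Data.Integer.Properties as ℤP
open import Data.Rational using (ℚ; 0ℚ; 1ℚ; _+_; _*_; -_; _-_; toℚᵘ)
import Data.Rational.Properties as QP
import Data.Rational.Unnormalised as U
import Data.Rational.Unnormalised.Properties as UP
open import Data.Rational.Solver using (module +-*-Solver)
open +-*-Solver using (solve; _:+_; _:*_; _:-_; :-_; _:=_; con)
open import Data.Bool using (Bool; true; false; if_then_else_; _∧_; not)
open import Relation.Nullary using (¬_; Dec; yes; no)
open import Relation.Nullary.Decidable using (does; dec-true; dec-false)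
open import Relation.Binary.PropositionalEquality
  using (refl; sym; trans; cong; cong₂; subst; subst₂; module ≡-Reasoning)
import Relation.Binary.Reasoning.Setoid as SetoidReasoning
import Function.Properties.Equivalence as ⇔
open import Function.Bundles using (_⇔_; mk⇔; Equivalence)
open import Data.Vec as V using ([]; _∷_; replicate; toList)
import Data.Vec.Properties as VP
open import Data.List as L using (List; []; _∷_; _++_; concatMap; applyUpTo; filterᵇ; length)
import Data.List.Properties as LP
open import Data.Fin as F using (Fin)
open import Data.List.Relation.Unary.All as All using (All; []; _∷_)
import Data.List.Relation.Unary.All.Properties as AllP
open import Data.List.Relation.Unary.Linked as Linked using ([]; [-]; _∷_)
open import Data.List.Relation.Binary.Permutation.Propositional
  using (_↭_; ↭-sym; ↭-trans; ↭⇒↭ₛ; ↭-reflexive)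
open import Data.List.Relation.Binary.Permutation.Propositional.Properties
  using (↭-length; All-resp-↭)
open import Data.List.Relation.Binary.Pointwise using (Pointwise-≡⇒≡)
open import Data.Product using (_×_; _,_; proj₁)
open import Relation.Binary.Bundles using (TotalOrder; DecTotalOrder)
open import Relation.Binary.Properties.DecTotalOrder NP.≤-decTotalOrder using (≥-decTotalOrder)
open import Relation.Binary.Definitions using (tri<; tri≈; tri>)
import Data.List.Sort.InsertionSort.Base as InsertionSort
import Data.List.Sort.InsertionSort.Properties as InsertionSortProperties
open import Data.List.Relation.Unary.Sorted.TotalOrder using (Sorted)
import Data.List.Relation.Unary.Sorted.TotalOrder.Properties as SortedProperties

private variable m : ℕ

χ : Bool → ℚ
χ b = if b then 1ℚ else 0ℚ

χ-∧ : ∀ b c → χ (b ∧ c) ≡ χ b * χ c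
χ-∧ true  c = sym (QP.*-identityˡ (χ c))
χ-∧ false c = sym (QP.*-zeroˡ (χ c))

χ-⇔ : ∀ {P Q : Set} (P? : Dec P) (Q? : Dec Q) → P ⇔ Q → χ (does P?) ≡ χ (does Q?)
χ-⇔ (yes p) Q? P⇔Q = cong χ (sym (dec-true Q? (Equivalence.to P⇔Q p)))
χ-⇔ (no ¬p) Q? P⇔Q = cong χ (sym (dec-false Q? (λ q → ¬p (Equivalence.from P⇔Q q))))

δ : ℕ → ℕ → ℚ
δ a b = χ (does (a ℕ.≟ b))

δ-refl : ∀ a → δ a a ≡ 1ℚ
δ-refl a = cong χ (dec-true (a ℕ.≟ a) refl)

δ-≢ : ∀ {a b} → ¬ a ≡ b → δ a b ≡ 0ℚ
δ-≢ {a} {b} a≢b = cong χ (dec-false (a ℕ.≟ b) a≢b)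

δ-guard : ∀ a b {x y} → (a ≡ b → x ≡ y) → δ a b * x ≡ δ a b * y
δ-guard a b {x} {y} f with a ℕ.≟ b
... | yes a≡b = cong (δ a b *_) (f a≡b)
... | no  a≢b = begin
  δ a b * x ≡⟨ cong (_* x) (δ-≢ a≢b) ⟩
  0ℚ * x    ≡⟨ QP.*-zeroˡ x ⟩
  0ℚ        ≡⟨ QP.*-zeroˡ y ⟨
  0ℚ * y    ≡⟨ cong (_* y) (δ-≢ a≢b) ⟨
  δ a b * y ∎
  where open ≡-Reasoning

δ-guardʳ : ∀ a b {x y} → (a ≡ b → x ≡ y) → x * δ a b ≡ y * δ a b
δ-guardʳ a b {x} {y} f = trans (QP.*-comm x (δ a b)) (trans (δ-guard a b f) (QP.*-comm (δ a b) y))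

δ-+ʳ : ∀ x y c → δ (x ℕ.+ c) (y ℕ.+ c) ≡ δ x y
δ-+ʳ x y zero    = cong₂ δ (NP.+-identityʳ x) (NP.+-identityʳ y)
δ-+ʳ x y (suc c) = trans (cong₂ δ (NP.+-suc x c) (NP.+-suc y c)) (δ-+ʳ x y c)

δ-cancel : ∀ A c W d → δ (A ℕ.+ (c ℕ.+ W)) (d ℕ.+ c) ≡ δ (A ℕ.+ W) d
δ-cancel A c W d = trans (cong (λ u → δ u (d ℕ.+ c)) rearrange) (δ-+ʳ (A ℕ.+ W) d c)
  where
  rearrange : A ℕ.+ (c ℕ.+ W) ≡ A ℕ.+ W ℕ.+ c
  rearrange = trans (cong (A ℕ.+_) (NP.+-comm c W)) (sym (NP.+-assoc A W c))

χ≤ : ℕ → ℕ → ℚ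
χ≤ zero    b       = 1ℚ
χ≤ (suc a) zero    = 0ℚ
χ≤ (suc a) (suc b) = χ≤ a b

χ≤-≤ : ∀ {a b} → a ≤ b → χ≤ a b ≡ 1ℚ
χ≤-≤ z≤n       = refl
χ≤-≤ (s≤s a≤b) = χ≤-≤ a≤b

χ≤-> : ∀ {a b} → b < a → χ≤ a b ≡ 0ℚ
χ≤-> {suc a} {zero}  _         = refl
χ≤-> {suc a} {suc b} (s≤s b<a) = χ≤-> b<a

χ≤-⊓ : ∀ x b n → χ≤ x (b ⊓ n) ≡ χ≤ x b * χ≤ x n
χ≤-⊓ zero    b       n       = sym (QP.*-identityˡ 1ℚ)
χ≤-⊓ (suc x) zero    n       = sym (QP.*-zeroˡ (χ≤ (suc x) n))
χ≤-⊓ (suc x) (suc b) zero    = sym (QP.*-zeroʳ (χ≤ x b))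
χ≤-⊓ (suc x) (suc b) (suc n) = χ≤-⊓ x b n

χ≤-δ-∸ : ∀ x y n → χ≤ x n * δ y (n ∸ x) ≡ δ (x ℕ.+ y) n
χ≤-δ-∸ zero    y n       = QP.*-identityˡ (δ y n)
χ≤-δ-∸ (suc x) y zero    = QP.*-zeroˡ (δ y 0)
χ≤-δ-∸ (suc x) y (suc n) = χ≤-δ-∸ x y n

ι : ℕ → ℚ
ι = ℕ→ℚ

ι-+ : ∀ a b → ι (a ℕ.+ b) ≡ ι a + ι b
ι-+ a b = QP.toℚᵘ-injective (begin
    toℚᵘ (ι (a ℕ.+ b))               ≈⟨ QP.toℚᵘ-fromℚᵘ (U.mkℚᵘ (ℤ.+ (a ℕ.+ b)) 0) ⟩
    U.mkℚᵘ (ℤ.+ (a ℕ.+ b)) 0         ≈⟨ U.*≡* cross ⟩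
    U.mkℚᵘ (ℤ.+ a) 0 U.+ U.mkℚᵘ (ℤ.+ b) 0
      ≈⟨ UP.≃-sym (UP.+-cong (QP.toℚᵘ-fromℚᵘ (U.mkℚᵘ (ℤ.+ a) 0)) (QP.toℚᵘ-fromℚᵘ (U.mkℚᵘ (ℤ.+ b) 0))) ⟩
    toℚᵘ (ι a) U.+ toℚᵘ (ι b)        ≈⟨ UP.≃-sym (QP.toℚᵘ-homo-+ (ι a) (ι b)) ⟩
    toℚᵘ (ι a + ι b)                 ∎)
  where
  open SetoidReasoning UP.≃-setoid
  cross : ℤ.+ (a ℕ.+ b) ℤ.* ℤ.+ 1 ≡ (ℤ.+ a ℤ.* ℤ.+ 1 ℤ.+ ℤ.+ b ℤ.* ℤ.+ 1) ℤ.* ℤ.+ 1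
  cross = trans (ℤP.*-identityʳ _) (sym (trans (ℤP.*-identityʳ _)
            (cong₂ ℤ._+_ (ℤP.*-identityʳ (ℤ.+ a)) (ℤP.*-identityʳ (ℤ.+ b)))))

x+y≡w⇒x≡w-y : ∀ x y w → x + y ≡ w → x ≡ w - y
x+y≡w⇒x≡w-y x y w e = trans (solve 2 (λ x y → x := (x :+ y) :- y) refl x y) (cong (_- y) e)

Σ≤-head : ∀ n (f : ℕ → ℚ) → Σ≤ (suc n) f ≡ f 0 + Σ≤ n (λ i → f (suc i))
Σ≤-head zero    f = refl
Σ≤-head (suc n) f = trans (cong (_+ f (suc (suc n))) (Σ≤-head n f)) (QP.+-assoc (f 0) _ _)

Σ≤-cong : ∀ n {f g : ℕ → ℚ} → (∀ i → i ≤ n → f i ≡ g i) → Σ≤ n f ≡ Σ≤ n g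
Σ≤-cong zero    f≡g = f≡g 0 z≤n
Σ≤-cong (suc n) f≡g =
  cong₂ _+_ (Σ≤-cong n (λ i i≤n → f≡g i (NP.m≤n⇒m≤1+n i≤n))) (f≡g (suc n) NP.≤-refl)

Σ≤-cong′ : ∀ n {f g : ℕ → ℚ} → (∀ i → f i ≡ g i) → Σ≤ n f ≡ Σ≤ n g
Σ≤-cong′ n f≡g = Σ≤-cong n (λ i _ → f≡g i)

Σ≤-+ : ∀ n (f g : ℕ → ℚ) → Σ≤ n (λ i → f i + g i) ≡ Σ≤ n f + Σ≤ n g
Σ≤-+ zero    f g = refl
Σ≤-+ (suc n) f g = trans (cong (_+ (f (suc n) + g (suc n))) (Σ≤-+ n f g))
  (solve 4 (λ a b c d → (a :+ b) :+ (c :+ d) := (a :+ c) :+ (b :+ d)) refl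
     (Σ≤ n f) (Σ≤ n g) (f (suc n)) (g (suc n)))

Σ≤-*ˡ : ∀ n c (f : ℕ → ℚ) → Σ≤ n (λ i → c * f i) ≡ c * Σ≤ n f
Σ≤-*ˡ zero    c f = refl
Σ≤-*ˡ (suc n) c f = trans (cong (_+ (c * f (suc n))) (Σ≤-*ˡ n c f))
  (sym (QP.*-distribˡ-+ c (Σ≤ n f) (f (suc n))))

Σ≤-*ʳ : ∀ n c (f : ℕ → ℚ) → Σ≤ n (λ i → f i * c) ≡ Σ≤ n f * c
Σ≤-*ʳ n c f = trans (Σ≤-cong′ n (λ i → QP.*-comm (f i) c))
  (trans (Σ≤-*ˡ n c f) (QP.*-comm c (Σ≤ n f)))

Σ≤-neg : ∀ n (f : ℕ → ℚ) → Σ≤ n (λ i → - f i) ≡ - Σ≤ n f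
Σ≤-neg zero    f = refl
Σ≤-neg (suc n) f = trans (cong (_+ (- f (suc n))) (Σ≤-neg n f))
  (solve 2 (λ x y → (:- x) :+ (:- y) := :- (x :+ y)) refl (Σ≤ n f) (f (suc n)))

Σ≤-zero : ∀ n {f : ℕ → ℚ} → (∀ i → f i ≡ 0ℚ) → Σ≤ n f ≡ 0ℚ
Σ≤-zero zero    f≡0 = f≡0 0
Σ≤-zero (suc n) f≡0 = trans (cong₂ _+_ (Σ≤-zero n f≡0) (f≡0 (suc n))) (QP.+-identityˡ 0ℚ)

Σ≤-first : ∀ n {f : ℕ → ℚ} → (∀ i → f (suc i) ≡ 0ℚ) → Σ≤ n f ≡ f 0
Σ≤-first zero    _   = refl
Σ≤-first (suc n) {f} f₊≡0 =
  trans (Σ≤-head n f) (trans (cong (f 0 +_) (Σ≤-zero n f₊≡0)) (QP.+-identityʳ (f 0)))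

Σ≤-δ : ∀ n c (f : ℕ → ℚ) → Σ≤ n (λ i → δ i c * f i) ≡ χ≤ c n * f c
Σ≤-δ zero    zero    f = refl
Σ≤-δ zero    (suc c) f = trans (QP.*-zeroˡ (f 0)) (sym (QP.*-zeroˡ (f (suc c))))
Σ≤-δ (suc n) zero    f = Σ≤-first (suc n) (λ i → QP.*-zeroˡ (f (suc i)))
Σ≤-δ (suc n) (suc c) f = trans (Σ≤-head n _)
  (trans (cong (_+ Σ≤ n (λ i → δ (suc i) (suc c) * f (suc i))) (QP.*-zeroˡ (f 0)))
  (trans (QP.+-identityˡ _) (Σ≤-δ n c (λ i → f (suc i)))))

*C-congˡ : ∀ {f f′ g : Coef m} → (∀ β → f β ≡ f′ β) → ∀ α → (f *C g) α ≡ (f′ *C g) α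
*C-congˡ {zero}  {g = g} f≡f′ []      = cong (_* g []) (f≡f′ [])
*C-congˡ {suc m}         f≡f′ (a ∷ α) = Σ≤-cong′ a (λ i → *C-congˡ (λ β → f≡f′ (i ∷ β)) α)

*C-congʳ : ∀ {f g g′ : Coef m} → (∀ β → g β ≡ g′ β) → ∀ α → (f *C g) α ≡ (f *C g′) α
*C-congʳ {zero}  {f = f} g≡g′ []      = cong (f [] *_) (g≡g′ [])
*C-congʳ {suc m}         g≡g′ (a ∷ α) = Σ≤-cong′ a (λ i → *C-congʳ (λ β → g≡g′ ((a ∸ i) ∷ β)) α)

*C-distribʳ : ∀ (f f′ g : Coef m) α → ((f +C f′) *C g) α ≡ (f *C g) α + (f′ *C g) α
*C-distribʳ {zero}  f f′ g []      = QP.*-distribʳ-+ (g []) (f []) (f′ [])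
*C-distribʳ {suc m} f f′ g (a ∷ α) =
  trans (Σ≤-cong′ a (λ i → *C-distribʳ _ _ _ α)) (Σ≤-+ a _ _)

*C-scalarˡ : ∀ c (f g : Coef m) α → ((c ·C f) *C g) α ≡ c * (f *C g) α
*C-scalarˡ {zero}  c f g []      = QP.*-assoc c (f []) (g [])
*C-scalarˡ {suc m} c f g (a ∷ α) = trans (Σ≤-cong′ a (λ i → *C-scalarˡ c _ _ α)) (Σ≤-*ˡ a c _)

*C-negˡ : ∀ (f g : Coef m) α → ((λ β → - f β) *C g) α ≡ - (f *C g) α
*C-negˡ {zero}  f g []      = solve 2 (λ x y → (:- x) :* y := :- (x :* y)) refl (f []) (g [])
*C-negˡ {suc m} f g (a ∷ α) = trans (Σ≤-cong′ a (λ i → *C-negˡ _ _ α)) (Σ≤-neg a _)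

*C-zeroˡ : ∀ (g : Coef m) α → (zeroC *C g) α ≡ 0ℚ
*C-zeroˡ {zero}  g []      = QP.*-zeroˡ (g [])
*C-zeroˡ {suc m} g (a ∷ α) = Σ≤-zero a (λ i → *C-zeroˡ _ α)

*C-identityˡ : ∀ (g : Coef m) α → (oneC *C g) α ≡ g α
*C-identityˡ {zero}  g []          = QP.*-identityˡ (g [])
*C-identityˡ {suc m} g (zero ∷ α)  = *C-identityˡ _ α
*C-identityˡ {suc m} g (suc a ∷ α) = trans (Σ≤-first (suc a) (λ i → *C-zeroˡ _ α)) (*C-identityˡ _ α)

t*-zero : ∀ (G : Ser m) k α → (tS *S G) 0 k α ≡ 0ℚ
t*-zero G k α = Σ≤-zero k (λ b → *C-zeroˡ _ α)

t*-suc : ∀ (G : Ser m) n k α → (tS *S G) (suc n) k α ≡ G n k α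
t*-suc G n k α =
  trans (Σ≤-head n _)
  (trans (cong₂ _+_ (Σ≤-zero k (λ b → *C-zeroˡ _ α))
                    (Σ≤-first n (λ a → Σ≤-zero k (λ b → *C-zeroˡ _ α))))
  (trans (QP.+-identityˡ _)
  (trans (Σ≤-first k (λ b → *C-zeroˡ _ α)) (*C-identityˡ _ α))))

[1-s]*-zero : ∀ (G : Ser m) n α → (oneMinusS *S G) n 0 α ≡ G n 0 α
[1-s]*-zero G n α = trans (Σ≤-first n (λ a → *C-zeroˡ _ α)) (*C-identityˡ _ α)

[1-s]*-suc : ∀ (G : Ser m) n k α → (oneMinusS *S G) n (suc k) α ≡ G n (suc k) α - G n k α
[1-s]*-suc G n k α =
  trans (Σ≤-first n (λ a → Σ≤-zero (suc k) (λ b → *C-zeroˡ _ α)))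
  (trans (Σ≤-head k _)
  (cong₂ _+_ (*C-identityˡ _ α)
    (trans (Σ≤-first k (λ b → *C-zeroˡ _ α))
    (trans (*C-negˡ oneC (G n k) α) (cong -_ (*C-identityˡ _ α))))))

t∂t-coef : ∀ (F : Ser m) n k α → (tS *S ∂t F) n k α ≡ ι n * F n k α
t∂t-coef F zero    k α = trans (t*-zero (∂t F) k α) (sym (QP.*-zeroˡ (F 0 k α)))
t∂t-coef F (suc n) k α = t*-suc (∂t F) n k α

[1-s]∂s-coef : ∀ (F : Ser m) n k α →
  (oneMinusS *S ∂s F) n k α ≡ ι (suc k) * F n (suc k) α - ι k * F n k α
[1-s]∂s-coef F n zero    α = trans ([1-s]*-zero (∂s F) n α)
  (solve 2 (λ x y → x := x :- con 0ℚ :* y) refl (ι 1 * F n 1 α) (F n 0 α))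
[1-s]∂s-coef F n (suc k) α = [1-s]*-suc (∂s F) n k α

isPos : ℕ → ℕ
isPos zero    = 0
isPos (suc _) = 1

isPos-pos : ∀ {a} → 0 < a → isPos a ≡ 1
isPos-pos (s≤s z≤n) = refl

weight : Vec ℕ m → ℕ
weight []      = 0
weight (a ∷ α) = a ℕ.+ weight α

parts : Vec ℕ m → ℕ
parts []      = 0
parts (a ∷ α) = isPos a ℕ.+ parts α

parts≤weight : (α : Vec ℕ m) → parts α ≤ weight α
parts≤weight []          = z≤n
parts≤weight (zero  ∷ α) = parts≤weight α
parts≤weight (suc a ∷ α) = s≤s (NP.≤-trans (parts≤weight α) (NP.m≤n+m (weight α) a))

nAbove : ℕ → Vec ℕ m → ℚ
nAbove j []      = 0ℚ
nAbove j (a ∷ α) = χ (does (j ℕ.<? a)) + nAbove j α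

nAt : ℕ → Vec ℕ m → ℚ
nAt j []      = 0ℚ
nAt j (a ∷ α) = δ a j + nAt j α

-- The
-- offsets make the family closed under fixing the exponent of x₁ (shape-cons).
shape : ℕ → ℕ → ℕ → ℕ → Coef m
shape A Z d k γ = δ (A ℕ.+ weight γ) d * δ (Z ℕ.+ parts γ) k

shape-cons : ∀ A Z d k a (γ : Vec ℕ m) →
  shape A Z d k (a ∷ γ) ≡ shape (A ℕ.+ a) (Z ℕ.+ isPos a) d k γ
shape-cons A Z d k a γ = cong₂ (λ u v → δ u d * δ v k)
  (sym (NP.+-assoc A a (weight γ))) (sym (NP.+-assoc Z (isPos a) (parts γ)))

module Ascending  = InsertionSort NP.≤-decTotalOrder
module Descending = InsertionSort ≥-decTotalOrder
module AscendingP  = InsertionSortProperties NP.≤-decTotalOrder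
module DescendingP = InsertionSortProperties ≥-decTotalOrder

≤-order ≥-order : TotalOrder _ _ _
≤-order = DecTotalOrder.totalOrder NP.≤-decTotalOrder
≥-order = DecTotalOrder.totalOrder ≥-decTotalOrder

Decreasing : List ℕ → Set
Decreasing = Sorted ≥-order

increasing-unique : ∀ {xs ys} → Sorted ≤-order xs → Sorted ≤-order ys → xs ↭ ys → xs ≡ ys
increasing-unique xs↗ ys↗ xs↭ys = Pointwise-≡⇒≡ (SortedProperties.↗↭↗⇒≋ ≤-order xs↗ ys↗ (↭⇒↭ₛ xs↭ys))

decreasing-unique : ∀ {xs ys} → Decreasing xs → Decreasing ys → xs ↭ ys → xs ≡ ys
decreasing-unique xs↘ ys↘ xs↭ys = Pointwise-≡⇒≡ (SortedProperties.↗↭↗⇒≋ ≥-order xs↘ ys↘ (↭⇒↭ₛ xs↭ys))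

insert≡ : ∀ x xs → insert x xs ≡ Ascending.insert x xs
insert≡ x []       = refl
insert≡ x (y ∷ xs) with does (x ℕ.≤? y)
... | true  = refl
... | false = cong (y ∷_) (insert≡ x xs)

sort≡ : ∀ xs → sort xs ≡ Ascending.sort xs
sort≡ []       = refl
sort≡ (x ∷ xs) = trans (cong (insert x) (sort≡ xs)) (insert≡ x (Ascending.sort xs))

sort-↭ : ∀ xs → sort xs ↭ xs
sort-↭ xs = subst (_↭ xs) (sym (sort≡ xs)) (AscendingP.sort-↭ xs)

sort-≡⇔↭ : ∀ xs ys → (sort xs ≡ sort ys) ⇔ (xs ↭ ys)
sort-≡⇔↭ xs ys = mk⇔
  (λ e → ↭-trans (↭-sym (sort-↭ xs)) (↭-trans (↭-reflexive e) (sort-↭ ys)))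
  (λ xs↭ys → trans (sort≡ xs) (trans
     (increasing-unique (AscendingP.sort-↗ xs) (AscendingP.sort-↗ ys)
        (↭-trans (AscendingP.sort-↭ xs) (↭-trans xs↭ys (↭-sym (AscendingP.sort-↭ ys)))))
     (sym (sort≡ ys))))

decreasing-≡⇔↭ : ∀ {l} xs → Decreasing l → (l ≡ Descending.sort xs) ⇔ (xs ↭ l)
decreasing-≡⇔↭ {l} xs l↘ = mk⇔
  (λ e → ↭-trans (↭-sym (DescendingP.sort-↭ xs)) (↭-reflexive (sym e)))
  (λ xs↭l → decreasing-unique l↘ (DescendingP.sort-↗ xs)
     (↭-trans (↭-sym xs↭l) (↭-sym (DescendingP.sort-↭ xs))))

ΣL : {A : Set} → (A → ℚ) → List A → ℚ
ΣL f []       = 0ℚ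
ΣL f (x ∷ xs) = f x + ΣL f xs

ΣL-++ : {A : Set} (f : A → ℚ) (xs ys : List A) → ΣL f (xs ++ ys) ≡ ΣL f xs + ΣL f ys
ΣL-++ f []       ys = sym (QP.+-identityˡ _)
ΣL-++ f (x ∷ xs) ys = trans (cong (f x +_) (ΣL-++ f xs ys)) (sym (QP.+-assoc (f x) _ _))

ΣL-concatMap : {A B : Set} (f : B → ℚ) (h : A → List B) (xs : List A) →
  ΣL f (concatMap h xs) ≡ ΣL (λ x → ΣL f (h x)) xs
ΣL-concatMap f h []       = refl
ΣL-concatMap f h (x ∷ xs) =
  trans (ΣL-++ f (h x) (concatMap h xs)) (cong (ΣL f (h x) +_) (ΣL-concatMap f h xs))

ΣL-map : {A B : Set} (f : B → ℚ) (g : A → B) (xs : List A) → ΣL f (L.map g xs) ≡ ΣL (λ x → f (g x)) xs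
ΣL-map f g []       = refl
ΣL-map f g (x ∷ xs) = cong (f (g x) +_) (ΣL-map f g xs)

ΣL-*ˡ : {A : Set} (c : ℚ) (f : A → ℚ) (xs : List A) → ΣL (λ x → c * f x) xs ≡ c * ΣL f xs
ΣL-*ˡ c f []       = sym (QP.*-zeroʳ c)
ΣL-*ˡ c f (x ∷ xs) = trans (cong (c * f x +_) (ΣL-*ˡ c f xs)) (sym (QP.*-distribˡ-+ c _ _))

ΣL-cong : {A : Set} {f g : A → ℚ} {xs : List A} → All (λ x → f x ≡ g x) xs → ΣL f xs ≡ ΣL g xs
ΣL-cong []           = refl
ΣL-cong (e ∷ f≡g) = cong₂ _+_ e (ΣL-cong f≡g)

ΣL-zero : {A : Set} {f : A → ℚ} (xs : List A) → (∀ x → f x ≡ 0ℚ) → ΣL f xs ≡ 0ℚ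
ΣL-zero []       f≡0 = refl
ΣL-zero (x ∷ xs) f≡0 = trans (cong₂ _+_ (f≡0 x) (ΣL-zero xs f≡0)) (QP.+-identityˡ 0ℚ)

ΣL-applyUpTo : ∀ c (f : ℕ → ℕ) (G : ℕ → ℚ) → ΣL G (applyUpTo f (suc c)) ≡ Σ≤ c (λ i → G (f i))
ΣL-applyUpTo zero    f G = QP.+-identityʳ _
ΣL-applyUpTo (suc c) f G = trans (cong (G (f 0) +_) (ΣL-applyUpTo c (λ i → f (suc i)) G))
  (sym (Σ≤-head c (λ i → G (f i))))

ΣL-δ-upTo : ∀ c x (f : ℕ → ℚ) → ΣL (λ i → δ i (suc x) * f i) (applyUpTo suc c) ≡ χ≤ (suc x) c * f (suc x)
ΣL-δ-upTo zero    x f = sym (QP.*-zeroˡ (f (suc x)))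
ΣL-δ-upTo (suc c) x f = trans (ΣL-applyUpTo c suc (λ i → δ i (suc x) * f i)) (Σ≤-δ c x (λ i → f (suc i)))

partitionsBounded-suc : ∀ n k b → partitionsBounded n (suc k) b
  ≡ concatMap (λ i → L.map (i ∷_) (partitionsBounded (n ∸ i) k i)) (applyUpTo suc (b ⊓ n))
partitionsBounded-suc zero    k b = refl
partitionsBounded-suc (suc n) k b = refl

partitions-decreasing : ∀ n k b → All (λ l → Decreasing l × All (_≤ b) l) (partitionsBounded n k b)
partitions-decreasing zero    zero    b = ([] , []) ∷ []
partitions-decreasing (suc n) zero    b = []
partitions-decreasing n       (suc k) b =
  subst (All (λ l → Decreasing l × All (_≤ b) l)) (sym (partitionsBounded-suc n k b))
    (AllP.concat⁺ (AllP.map⁺ (AllP.applyUpTo⁺₁ suc (b ⊓ n) (λ {i} i<b⊓n →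
      AllP.map⁺ (All.map (extend (NP.≤-trans i<b⊓n (NP.m⊓n≤m b n)))
                         (partitions-decreasing (n ∸ suc i) k (suc i)))))))
  where
  extend : ∀ {j l} → j ≤ b → Decreasing l × All (_≤ j) l → Decreasing (j ∷ l) × All (_≤ b) (j ∷ l)
  extend {l = []}    j≤b _                  = [-] , (j≤b ∷ [])
  extend {l = y ∷ l} j≤b (l↘ , (y≤j ∷ l≤j)) =
    (y≤j ∷ l↘) , (j≤b ∷ NP.≤-trans y≤j j≤b ∷ All.map (λ h → NP.≤-trans h j≤b) l≤j)

headBelow : List ℕ → ℕ → ℚ
headBelow []      b = 1ℚ
headBelow (x ∷ _) b = χ≤ x b

headBelow-decreasing : ∀ x ν → Decreasing (x ∷ ν) → headBelow ν x ≡ 1ℚ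
headBelow-decreasing x []      _       = refl
headBelow-decreasing x (y ∷ ν) (y≤x ∷ _) = χ≤-≤ y≤x

headBelow-sum : ∀ ν n → sum ν ≤ n → headBelow ν n ≡ 1ℚ
headBelow-sum []      n _     = refl
headBelow-sum (x ∷ ν) n ν≤n = χ≤-≤ (NP.≤-trans (NP.m≤m+n x (sum ν)) ν≤n)

occ : List (List ℕ) → List ℕ → ℚ
occ L ν = ΣL (λ l → χ (does (LP.≡-dec ℕ._≟_ l ν))) L

occ-map-∷ : ∀ i y L ν → occ (L.map (i ∷_) L) (y ∷ ν) ≡ δ i y * occ L ν
occ-map-∷ i y L ν =
  trans (ΣL-map (λ l → χ (does (LP.≡-dec ℕ._≟_ l (y ∷ ν)))) (i ∷_) L)
  (trans (ΣL-cong (All.universal (λ l → χ-∧ (does (i ℕ.≟ y)) (does (LP.≡-dec ℕ._≟_ l ν))) L))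
         (ΣL-*ˡ (δ i y) (λ l → χ (does (LP.≡-dec ℕ._≟_ l ν))) L))

occ-partitions : ∀ n k b ν → Decreasing ν → All (1 ≤_) ν →
  occ (partitionsBounded n k b) ν ≡ δ (sum ν) n * δ (length ν) k * headBelow ν b
occ-partitions zero    zero    b []      _ _ = refl
occ-partitions zero    zero    b (x ∷ ν) _ _ =
  solve 2 (λ u v → con 0ℚ :+ con 0ℚ := u :* con 0ℚ :* v) refl (δ (sum (x ∷ ν)) 0) (χ≤ x b)
occ-partitions (suc n) zero    b []      _ _ = refl
occ-partitions (suc n) zero    b (x ∷ ν) _ _ =
  solve 2 (λ u v → con 0ℚ := u :* con 0ℚ :* v) refl (δ (sum (x ∷ ν)) (suc n)) (χ≤ x b)
occ-partitions n       (suc k) b []      _ _ = begin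
  occ (partitionsBounded n (suc k) b) []
    ≡⟨ cong (λ L → occ L []) (partitionsBounded-suc n k b) ⟩
  occ (concatMap H (applyUpTo suc (b ⊓ n))) []
    ≡⟨ ΣL-concatMap _ H (applyUpTo suc (b ⊓ n)) ⟩
  ΣL (λ i → occ (H i) []) (applyUpTo suc (b ⊓ n))
    ≡⟨ ΣL-zero (applyUpTo suc (b ⊓ n))
         (λ i → trans (ΣL-map _ (i ∷_) (partitionsBounded (n ∸ i) k i))
                      (ΣL-zero (partitionsBounded (n ∸ i) k i) (λ _ → refl))) ⟩
  0ℚ
    ≡⟨ solve 1 (λ u → con 0ℚ := u :* con 0ℚ :* con 1ℚ) refl (δ 0 n) ⟩
  δ 0 n * δ 0 (suc k) * 1ℚ ∎
  where
  open ≡-Reasoning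
  H : ℕ → List (List ℕ)
  H i = L.map (i ∷_) (partitionsBounded (n ∸ i) k i)
occ-partitions n       (suc k) b (suc x ∷ ν) ν↘ (_ ∷ ν>0) = begin
  occ (partitionsBounded n (suc k) b) (suc x ∷ ν)
    ≡⟨ cong (λ L → occ L (suc x ∷ ν)) (partitionsBounded-suc n k b) ⟩
  occ (concatMap H (applyUpTo suc (b ⊓ n))) (suc x ∷ ν)
    ≡⟨ ΣL-concatMap _ H (applyUpTo suc (b ⊓ n)) ⟩
  ΣL (λ i → occ (H i) (suc x ∷ ν)) (applyUpTo suc (b ⊓ n))
    ≡⟨ ΣL-cong (All.universal (λ i → occ-map-∷ i (suc x) (partitionsBounded (n ∸ i) k i) ν)
                              (applyUpTo suc (b ⊓ n))) ⟩
  ΣL (λ i → δ i (suc x) * rest i) (applyUpTo suc (b ⊓ n))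
    ≡⟨ ΣL-δ-upTo (b ⊓ n) x rest ⟩
  χ≤ (suc x) (b ⊓ n) * rest (suc x)
    ≡⟨ cong₂ _*_ (χ≤-⊓ (suc x) b n) (occ-partitions (n ∸ suc x) k (suc x) ν (Linked.tail ν↘) ν>0) ⟩
  χ≤ (suc x) b * χ≤ (suc x) n * (δ (sum ν) (n ∸ suc x) * δ (length ν) k * headBelow ν (suc x))
    ≡⟨ cong (λ u → χ≤ (suc x) b * χ≤ (suc x) n * (δ (sum ν) (n ∸ suc x) * δ (length ν) k * u))
            (headBelow-decreasing (suc x) ν ν↘) ⟩
  χ≤ (suc x) b * χ≤ (suc x) n * (δ (sum ν) (n ∸ suc x) * δ (length ν) k * 1ℚ)
    ≡⟨ solve 4 (λ a b c d → a :* b :* (c :* d :* con 1ℚ) := (b :* c) :* d :* a) refl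
         (χ≤ (suc x) b) (χ≤ (suc x) n) (δ (sum ν) (n ∸ suc x)) (δ (length ν) k) ⟩
  χ≤ (suc x) n * δ (sum ν) (n ∸ suc x) * δ (length ν) k * χ≤ (suc x) b
    ≡⟨ cong (λ u → u * δ (length ν) k * χ≤ (suc x) b) (χ≤-δ-∸ (suc x) (sum ν) n) ⟩
  δ (suc x ℕ.+ sum ν) n * δ (length ν) k * χ≤ (suc x) b ∎
  where
  open ≡-Reasoning
  H : ℕ → List (List ℕ)
  H i = L.map (i ∷_) (partitionsBounded (n ∸ i) k i)
  rest : ℕ → ℚ
  rest i = occ (partitionsBounded (n ∸ i) k i) ν

nonzeros : Vec ℕ m → List ℕ
nonzeros α = filterᵇ (λ a → not (does (a ℕ.≟ 0))) (toList α)

sum-nonzeros : (α : Vec ℕ m) → sum (nonzeros α) ≡ weight α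
sum-nonzeros []          = refl
sum-nonzeros (zero  ∷ α) = sum-nonzeros α
sum-nonzeros (suc a ∷ α) = cong (suc a ℕ.+_) (sum-nonzeros α)

length-nonzeros : (α : Vec ℕ m) → length (nonzeros α) ≡ parts α
length-nonzeros []          = refl
length-nonzeros (zero  ∷ α) = length-nonzeros α
length-nonzeros (suc a ∷ α) = cong suc (length-nonzeros α)

nonzeros-positive : (α : Vec ℕ m) → All (1 ≤_) (nonzeros α)
nonzeros-positive []          = []
nonzeros-positive (zero  ∷ α) = nonzeros-positive α
nonzeros-positive (suc a ∷ α) = s≤s z≤n ∷ nonzeros-positive α

shapeOf : Vec ℕ m → List ℕ
shapeOf α = Descending.sort (nonzeros α)

mono-decreasing : ∀ l (α : Vec ℕ m) → Decreasing l →
  mono l α ≡ χ (does (LP.≡-dec ℕ._≟_ l (shapeOf α)))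
mono-decreasing l α l↘ = χ-⇔ (LP.≡-dec ℕ._≟_ (sort (nonzeros α)) (sort l)) (LP.≡-dec ℕ._≟_ l (shapeOf α))
  (⇔.trans (sort-≡⇔↭ (nonzeros α) l) (⇔.sym (decreasing-≡⇔↭ (nonzeros α) l↘)))

N-pointwise : ∀ n k (α : Vec ℕ m) → N n k α ≡ ΣL (λ l → mono l α) (partitions n k)
N-pointwise n k α = go (partitions n k)
  where
  go : ∀ L → L.foldr _+C_ zeroC (L.map mono L) α ≡ ΣL (λ l → mono l α) L
  go []      = refl
  go (l ∷ L) = cong (mono l α +_) (go L)

N-coef : ∀ n k (α : Vec ℕ m) → N n k α ≡ δ (weight α) n * δ (parts α) k
N-coef n k α = begin
  N n k α
    ≡⟨ N-pointwise n k α ⟩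
  ΣL (λ l → mono l α) (partitions n k)
    ≡⟨ ΣL-cong (All.map (λ {l} l↘ → mono-decreasing l α (proj₁ l↘)) (partitions-decreasing n k n)) ⟩
  occ (partitions n k) ν
    ≡⟨ occ-partitions n k n ν (DescendingP.sort-↗ (nonzeros α))
         (All-resp-↭ (↭-sym (DescendingP.sort-↭ (nonzeros α))) (nonzeros-positive α)) ⟩
  δ (sum ν) n * δ (length ν) k * headBelow ν n
    ≡⟨ cong₂ (λ u v → δ u n * δ v k * headBelow ν n) sum-ν length-ν ⟩
  δ (weight α) n * δ (parts α) k * headBelow ν n
    ≡⟨ QP.*-assoc (δ (weight α) n) (δ (parts α) k) (headBelow ν n) ⟩
  δ (weight α) n * (δ (parts α) k * headBelow ν n)
    ≡⟨ δ-guard (weight α) n (λ w≡n → trans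
         (cong (δ (parts α) k *_) (headBelow-sum ν n (NP.≤-reflexive (trans sum-ν w≡n))))
         (QP.*-identityʳ (δ (parts α) k))) ⟩
  δ (weight α) n * δ (parts α) k ∎
  where
  open ≡-Reasoning
  ν : List ℕ
  ν = shapeOf α
  sum-ν : sum ν ≡ weight α
  sum-ν = trans (NLP.sum-↭ (DescendingP.sort-↭ (nonzeros α))) (sum-nonzeros α)
  length-ν : length ν ≡ parts α
  length-ν = trans (↭-length (DescendingP.sort-↭ (nonzeros α))) (length-nonzeros α)

-- The terms of 𝓕 with s-degree k + 1: N_{n,k+1} when k < n, and 0 otherwise,
-- which is consistent because ℓ(α) ≤ |α|.
guarded-N-coef : ∀ n k (α : Vec ℕ m) (k<n : Dec (suc k ≤ n)) →
  (if does k<n then N n (suc k) else zeroC) α ≡ shape 0 0 n (suc k) α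
guarded-N-coef n k α (yes _)   = N-coef n (suc k) α
guarded-N-coef n k α (no  k≮n) = sym (trans
  (δ-guard (weight α) n (λ w≡n → δ-≢ (λ ℓ≡k → k≮n (subst₂ _≤_ ℓ≡k w≡n (parts≤weight α)))))
  (QP.*-zeroʳ (δ (weight α) n)))

𝓕-coef : ∀ n k (α : Vec ℕ m) → 𝓕 n k α ≡ shape 0 0 n k α
𝓕-coef zero    zero    α = one-coef α
  where
  one-coef : (α : Vec ℕ m) → oneC α ≡ shape 0 0 0 0 α
  one-coef []          = sym (QP.*-identityˡ 1ℚ)
  one-coef (zero  ∷ α) = one-coef α
  one-coef (suc a ∷ α) = sym (QP.*-zeroˡ (δ (parts (suc a ∷ α)) 0))
𝓕-coef (suc n) zero    α = no-variables α
  where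
  -- a monomial of positive degree involves some variable
  no-variables : (α : Vec ℕ m) → 0ℚ ≡ shape 0 0 (suc n) 0 α
  no-variables []          = sym (QP.*-zeroˡ 1ℚ)
  no-variables (zero  ∷ α) = no-variables α
  no-variables (suc a ∷ α) = sym (QP.*-zeroʳ (δ (weight (suc a ∷ α)) (suc n)))
𝓕-coef zero    (suc k) α = guarded-N-coef zero k α (suc k ℕ.≤? zero)
𝓕-coef (suc n) (suc k) α = guarded-N-coef (suc n) k α (suc k ℕ.≤? suc n)

ΣFin-suc : ∀ m (f : Fin (suc m) → ℚ) → ΣFin (suc m) f ≡ f F.zero + ΣFin m (λ l → f (F.suc l))
ΣFin-suc m f = cong (λ xs → f F.zero + L.foldr _+_ 0ℚ xs)
  (trans (LP.map-tabulate F.suc f) (sym (LP.map-tabulate (λ l → l) (λ l → f (F.suc l)))))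

ΣFin-cong : ∀ m {f g : Fin m → ℚ} → (∀ l → f l ≡ g l) → ΣFin m f ≡ ΣFin m g
ΣFin-cong m f≡g = cong (L.foldr _+_ 0ℚ) (LP.map-cong f≡g (L.allFin m))

ΣFin-*ˡ : ∀ m c (f : Fin m → ℚ) → ΣFin m (λ l → c * f l) ≡ c * ΣFin m f
ΣFin-*ˡ zero    c f = sym (QP.*-zeroʳ c)
ΣFin-*ˡ (suc m) c f = begin
  ΣFin (suc m) (λ l → c * f l)
    ≡⟨ ΣFin-suc m (λ l → c * f l) ⟩
  c * f F.zero + ΣFin m (λ l → c * f (F.suc l))
    ≡⟨ cong (c * f F.zero +_) (ΣFin-*ˡ m c (λ l → f (F.suc l))) ⟩
  c * f F.zero + c * ΣFin m (λ l → f (F.suc l))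
    ≡⟨ QP.*-distribˡ-+ c _ _ ⟨
  c * (f F.zero + ΣFin m (λ l → f (F.suc l)))
    ≡⟨ cong (c *_) (ΣFin-suc m f) ⟨
  c * ΣFin (suc m) f ∎
  where open ≡-Reasoning

tabulate-0 : ∀ m → V.tabulate {n = m} (λ _ → 0) ≡ replicate m 0
tabulate-0 zero    = refl
tabulate-0 (suc m) = cong (0 ∷_) (tabulate-0 m)

p-cons : ∀ j i (β : Vec ℕ m) → p j (i ∷ β) ≡ δ i j * oneC β + δ i 0 * p j β
p-cons {m} j i β = trans (ΣFin-suc m (hits (i ∷ β))) (cong₂ _+_ x₁-term other-terms)
  where
  hits : ∀ {n} → Vec ℕ n → Fin n → ℚ
  hits γ l = χ (does (VP.≡-dec ℕ._≟_ γ (unitVec l j)))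
  x₁-term : χ (does (i ℕ.≟ j) ∧ does (VP.≡-dec ℕ._≟_ β (V.tabulate (λ _ → 0)))) ≡ δ i j * oneC β
  x₁-term = trans (χ-∧ (does (i ℕ.≟ j)) _)
    (cong (λ v → δ i j * χ (does (VP.≡-dec ℕ._≟_ β v))) (tabulate-0 m))
  other-terms : ΣFin m (λ l → χ (does (i ℕ.≟ 0) ∧ does (VP.≡-dec ℕ._≟_ β (unitVec l j)))) ≡ δ i 0 * p j β
  other-terms = trans (ΣFin-cong m (λ l → χ-∧ (does (i ℕ.≟ 0)) _)) (ΣFin-*ˡ m (δ i 0) (hits β))

-- The coefficient of x₁^a x^α in p_j · G: either x₁^j comes from p_j, or p_j
-- contributes a power of another variable and G supplies x₁^a.
p*-cons : ∀ j (G : Coef (suc m)) a (α : Vec ℕ m) →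
  (p j *C G) (a ∷ α) ≡ χ≤ j a * G ((a ∸ j) ∷ α) + (p j *C (λ γ → G (a ∷ γ))) α
p*-cons {m} j G a α = begin
  Σ≤ a (λ i → ((λ β → p j (i ∷ β)) *C G∸ i) α)
    ≡⟨ Σ≤-cong′ a split ⟩
  Σ≤ a (λ i → δ i j * G ((a ∸ i) ∷ α) + δ i 0 * (p j *C G∸ i) α)
    ≡⟨ Σ≤-+ a _ _ ⟩
  Σ≤ a (λ i → δ i j * G ((a ∸ i) ∷ α)) + Σ≤ a (λ i → δ i 0 * (p j *C G∸ i) α)
    ≡⟨ cong₂ _+_ (Σ≤-δ a j (λ i → G ((a ∸ i) ∷ α))) (Σ≤-δ a 0 (λ i → (p j *C G∸ i) α)) ⟩
  χ≤ j a * G ((a ∸ j) ∷ α) + 1ℚ * (p j *C G∸ 0) α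
    ≡⟨ cong (χ≤ j a * G ((a ∸ j) ∷ α) +_) (QP.*-identityˡ _) ⟩
  χ≤ j a * G ((a ∸ j) ∷ α) + (p j *C (λ γ → G (a ∷ γ))) α ∎
  where
  open ≡-Reasoning
  G∸ : ℕ → Coef m
  G∸ i γ = G ((a ∸ i) ∷ γ)
  split : ∀ i → ((λ β → p j (i ∷ β)) *C G∸ i) α ≡ δ i j * G ((a ∸ i) ∷ α) + δ i 0 * (p j *C G∸ i) α
  split i = trans (*C-congˡ (p-cons j i) α)
    (trans (*C-distribʳ (δ i j ·C oneC) (δ i 0 ·C p j) (G∸ i) α)
    (cong₂ _+_ (trans (*C-scalarˡ (δ i j) oneC (G∸ i) α) (cong (δ i j *_) (*C-identityˡ (G∸ i) α)))
               (*C-scalarˡ (δ i 0) (p j) (G∸ i) α)))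

-- The term of p*-cons where x₁^c (c ≥ 1) comes from p_c, for G = shape A Z d k,
-- is x₁-contribution: it survives iff α₁ ≥ c, and then x₁ still occurs iff α₁ > c.
x₁-contribution : ℕ → ℕ → ℕ → ℕ → ℕ → ℕ → Vec ℕ m → ℚ
x₁-contribution c a A Z d k α =
  δ (A ℕ.+ weight (a ∷ α)) (d ℕ.+ c) * (χ (does (c ℕ.<? a)) * δ ℓ k + δ a c * δ ℓ (suc k))
  where
  ℓ : ℕ
  ℓ = Z ℕ.+ parts (a ∷ α)

x₁-from-p-short : ∀ {c a} A Z d k (α : Vec ℕ m) → a < c →
  χ≤ c a * shape A Z d k ((a ∸ c) ∷ α) ≡ x₁-contribution c a A Z d k α
x₁-from-p-short {c = c} {a} A Z d k α a<c = begin
  χ≤ c a * shape A Z d k ((a ∸ c) ∷ α)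
    ≡⟨ cong (_* shape A Z d k ((a ∸ c) ∷ α)) (χ≤-> a<c) ⟩
  0ℚ * shape A Z d k ((a ∸ c) ∷ α)
    ≡⟨ QP.*-zeroˡ (shape A Z d k ((a ∸ c) ∷ α)) ⟩
  0ℚ
    ≡⟨ solve 3 (λ D K K′ → con 0ℚ := D :* (con 0ℚ :* K :+ con 0ℚ :* K′)) refl D K K′ ⟩
  D * (0ℚ * K + 0ℚ * K′)
    ≡⟨ cong₂ (λ u v → D * (u * K + v * K′))
         (cong χ (dec-false (c ℕ.<? a) (NP.<-asym a<c))) (δ-≢ (NP.<⇒≢ a<c)) ⟨
  D * (χ (does (c ℕ.<? a)) * K + δ a c * K′) ∎
  where
  open ≡-Reasoning
  D K K′ : ℚ
  D  = δ (A ℕ.+ weight (a ∷ α)) (d ℕ.+ c)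
  K  = δ (Z ℕ.+ parts (a ∷ α)) k
  K′ = δ (Z ℕ.+ parts (a ∷ α)) (suc k)

x₁-from-p-exact : ∀ c A Z d k (α : Vec ℕ m) →
  χ≤ (suc c) (suc c) * shape A Z d k ((suc c ∸ suc c) ∷ α) ≡ x₁-contribution (suc c) (suc c) A Z d k α
x₁-from-p-exact c A Z d k α = begin
  χ≤ (suc c) (suc c) * shape A Z d k ((suc c ∸ suc c) ∷ α)
    ≡⟨ cong₂ (λ u v → u * shape A Z d k (v ∷ α)) (χ≤-≤ (NP.≤-refl {suc c})) (NP.n∸n≡0 (suc c)) ⟩
  1ℚ * (δ (A ℕ.+ weight α) d * δ (Z ℕ.+ parts α) k)
    ≡⟨ solve 3 (λ D K K′ → con 1ℚ :* (D :* K) := D :* (con 0ℚ :* K′ :+ con 1ℚ :* K)) refl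
         (δ (A ℕ.+ weight α) d) (δ (Z ℕ.+ parts α) k) K ⟩
  δ (A ℕ.+ weight α) d * (0ℚ * K + 1ℚ * δ (Z ℕ.+ parts α) k)
    ≡⟨ cong₂ (λ u v → u * (0ℚ * K + 1ℚ * v)) (δ-cancel A (suc c) (weight α) d)
         (cong (λ u → δ u (suc k)) (NP.+-suc Z (parts α))) ⟨
  D * (0ℚ * K + 1ℚ * K′)
    ≡⟨ cong₂ (λ u v → D * (u * K + v * K′))
         (cong χ (dec-false (suc c ℕ.<? suc c) (NP.n≮n (suc c)))) (δ-refl (suc c)) ⟨
  D * (χ (does (suc c ℕ.<? suc c)) * K + δ (suc c) (suc c) * K′) ∎
  where
  open ≡-Reasoning
  D K K′ : ℚ
  D  = δ (A ℕ.+ (suc c ℕ.+ weight α)) (d ℕ.+ suc c)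
  K  = δ (Z ℕ.+ (1 ℕ.+ parts α)) k
  K′ = δ (Z ℕ.+ (1 ℕ.+ parts α)) (suc k)

x₁-from-p-long : ∀ {c a} A Z d k (α : Vec ℕ m) → c < a →
  χ≤ c a * shape A Z d k ((a ∸ c) ∷ α) ≡ x₁-contribution c a A Z d k α
x₁-from-p-long {c = c} {a} A Z d k α c<a = begin
  χ≤ c a * shape A Z d k ((a ∸ c) ∷ α)
    ≡⟨ cong₂ (λ u v → u * (D′ * K v)) (χ≤-≤ (NP.<⇒≤ c<a)) (isPos-pos (NP.m<n⇒0<n∸m c<a)) ⟩
  1ℚ * (D′ * K 1)
    ≡⟨ solve 3 (λ D K K′ → con 1ℚ :* (D :* K) := D :* (con 1ℚ :* K :+ con 0ℚ :* K′))
         refl D′ (K 1) (K′ 1) ⟩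
  D′ * (1ℚ * K 1 + 0ℚ * K′ 1)
    ≡⟨ cong₂ (λ u v → u * (1ℚ * K v + 0ℚ * K′ v)) weight-shift (isPos-pos (NP.<-≤-trans (s≤s z≤n) c<a)) ⟨
  D * (1ℚ * K (isPos a) + 0ℚ * K′ (isPos a))
    ≡⟨ cong₂ (λ u v → D * (u * K (isPos a) + v * K′ (isPos a)))
         (cong χ (dec-true (c ℕ.<? a) c<a)) (δ-≢ (NP.>⇒≢ c<a)) ⟨
  D * (χ (does (c ℕ.<? a)) * K (isPos a) + δ a c * K′ (isPos a)) ∎
  where
  open ≡-Reasoning
  D D′ : ℚ
  D  = δ (A ℕ.+ weight (a ∷ α)) (d ℕ.+ c)
  D′ = δ (A ℕ.+ ((a ∸ c) ℕ.+ weight α)) d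
  K K′ : ℕ → ℚ
  K  e = δ (Z ℕ.+ (e ℕ.+ parts α)) k
  K′ e = δ (Z ℕ.+ (e ℕ.+ parts α)) (suc k)
  -- a = c + (a − c), and the common summand c cancels
  weight-shift : D ≡ D′
  weight-shift = trans
    (cong (λ u → δ (A ℕ.+ u) (d ℕ.+ c))
      (trans (cong (ℕ._+ weight α) (sym (NP.m+[n∸m]≡n (NP.<⇒≤ c<a)))) (NP.+-assoc c (a ∸ c) (weight α))))
    (δ-cancel A c ((a ∸ c) ℕ.+ weight α) d)

x₁-from-p : ∀ c a A Z d k (α : Vec ℕ m) →
  χ≤ (suc c) a * shape A Z d k ((a ∸ suc c) ∷ α) ≡ x₁-contribution (suc c) a A Z d k α
x₁-from-p c a A Z d k α with NP.<-cmp a (suc c)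
... | tri< a<c _ _ = x₁-from-p-short A Z d k α a<c
... | tri≈ _ refl _ = x₁-from-p-exact c A Z d k α
... | tri> _ _ c<a = x₁-from-p-long A Z d k α c<a

-- p_c · [A + |·| = d][Z + ℓ(·) = k] (c ≥ 1): each entry α_i > c keeps the
-- number of variables, each entry α_i = c adds one.
p*shape : ∀ j A Z d k (α : Vec ℕ m) → let c = suc j; W = A ℕ.+ weight α; ℓ = Z ℕ.+ parts α in
  (p c *C shape A Z d k) α ≡ δ W (d ℕ.+ c) * (nAbove c α * δ ℓ k + nAt c α * δ ℓ (suc k))
p*shape j A Z d k [] = trans (QP.*-zeroˡ (shape A Z d k []))
  (solve 3 (λ D K K′ → con 0ℚ := D :* (con 0ℚ :* K :+ con 0ℚ :* K′)) refl
     (δ (A ℕ.+ 0) (d ℕ.+ suc j)) (δ (Z ℕ.+ 0) k) (δ (Z ℕ.+ 0) (suc k)))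
p*shape j A Z d k (a ∷ α) = begin
  (p c *C shape A Z d k) (a ∷ α)
    ≡⟨ p*-cons c (shape A Z d k) a α ⟩
  χ≤ c a * shape A Z d k ((a ∸ c) ∷ α) + (p c *C (λ γ → shape A Z d k (a ∷ γ))) α
    ≡⟨ cong₂ _+_ (x₁-from-p j a A Z d k α)
         (trans (*C-congʳ (shape-cons A Z d k a) α) (p*shape j (A ℕ.+ a) (Z ℕ.+ isPos a) d k α)) ⟩
  D * (u * K + v * K′) + rest (A ℕ.+ a ℕ.+ weight α) (Z ℕ.+ isPos a ℕ.+ parts α)
    ≡⟨ cong₂ (λ W ℓ → D * (u * K + v * K′) + rest W ℓ)
         (NP.+-assoc A a (weight α)) (NP.+-assoc Z (isPos a) (parts α)) ⟩
  D * (u * K + v * K′) + D * (nAbove c α * K + nAt c α * K′)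
    ≡⟨ solve 7 (λ D K K′ u v x y → D :* (u :* K :+ v :* K′) :+ D :* (x :* K :+ y :* K′)
                                   := D :* ((u :+ x) :* K :+ (v :+ y) :* K′))
         refl D K K′ u v (nAbove c α) (nAt c α) ⟩
  D * (nAbove c (a ∷ α) * K + nAt c (a ∷ α) * K′) ∎
  where
  open ≡-Reasoning
  c : ℕ
  c = suc j
  u v D K K′ : ℚ
  u  = χ (does (c ℕ.<? a))
  v  = δ a c
  D  = δ (A ℕ.+ weight (a ∷ α)) (d ℕ.+ c)
  K  = δ (Z ℕ.+ parts (a ∷ α)) k
  K′ = δ (Z ℕ.+ parts (a ∷ α)) (suc k)
  rest : ℕ → ℕ → ℚ
  rest W ℓ = δ W (d ℕ.+ c) * (nAbove c α * δ ℓ k + nAt c α * δ ℓ (suc k))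

Σ-below : ∀ b n → b ≤ suc n → Σ≤ n (λ j → χ (does (j ℕ.<? b))) ≡ ι b
Σ-below zero          n       _         = Σ≤-zero n (λ j → refl)
Σ-below (suc zero)    zero    _         = refl
Σ-below (suc b)       (suc n) (s≤s b≤n) =
  trans (Σ≤-head n _) (trans (cong (1ℚ +_) (Σ-below b n b≤n)) (sym (ι-+ 1 b)))

Σ-once : ∀ b n → b ≤ n → Σ≤ n (λ j → δ b j) ≡ 1ℚ
Σ-once zero    zero    _         = refl
Σ-once zero    (suc n) _         = Σ≤-first (suc n) (λ j → refl)
Σ-once (suc b) (suc n) (s≤s b≤n) = trans (Σ≤-head n _) (trans (QP.+-identityˡ _) (Σ-once b n b≤n))

Σ-above-entry : ∀ a n → a ≤ suc n → Σ≤ n (λ j → χ (does (suc j ℕ.<? a))) + ι (isPos a) ≡ ι a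
Σ-above-entry zero    n _         = trans (QP.+-identityʳ _) (Σ≤-zero n (λ j → refl))
Σ-above-entry (suc b) n (s≤s b≤n) = trans (cong (_+ 1ℚ) (Σ-below b n (NP.m≤n⇒m≤1+n b≤n)))
  (trans (QP.+-comm (ι b) 1ℚ) (sym (ι-+ 1 b)))

Σ-at-entry : ∀ a n → a ≤ suc n → Σ≤ n (λ j → δ a (suc j)) ≡ ι (isPos a)
Σ-at-entry zero    n _         = Σ≤-zero n (λ j → refl)
Σ-at-entry (suc b) n (s≤s b≤n) = Σ-once b n b≤n

Σ-nAbove : ∀ (α : Vec ℕ m) n → weight α ≤ suc n →
  Σ≤ n (λ j → nAbove (suc j) α) + ι (parts α) ≡ ι (weight α)
Σ-nAbove []      n _   = trans (QP.+-identityʳ _) (Σ≤-zero n (λ j → refl))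
Σ-nAbove (a ∷ α) n α≤n = begin
  Σ≤ n (λ j → χ (does (suc j ℕ.<? a)) + nAbove (suc j) α) + ι (isPos a ℕ.+ parts α)
    ≡⟨ cong₂ _+_ (Σ≤-+ n _ _) (ι-+ (isPos a) (parts α)) ⟩
  (X + Y) + (ι (isPos a) + ι (parts α))
    ≡⟨ solve 4 (λ X Y u v → (X :+ Y) :+ (u :+ v) := (X :+ u) :+ (Y :+ v))
         refl X Y (ι (isPos a)) (ι (parts α)) ⟩
  (X + ι (isPos a)) + (Y + ι (parts α))
    ≡⟨ cong₂ _+_ (Σ-above-entry a n (NP.≤-trans (NP.m≤m+n a (weight α)) α≤n))
                 (Σ-nAbove α n (NP.≤-trans (NP.m≤n+m (weight α) a) α≤n)) ⟩
  ι a + ι (weight α)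
    ≡⟨ ι-+ a (weight α) ⟨
  ι (a ℕ.+ weight α) ∎
  where
  open ≡-Reasoning
  X Y : ℚ
  X = Σ≤ n (λ j → χ (does (suc j ℕ.<? a)))
  Y = Σ≤ n (λ j → nAbove (suc j) α)

Σ-nAt : ∀ (α : Vec ℕ m) n → weight α ≤ suc n → Σ≤ n (λ j → nAt (suc j) α) ≡ ι (parts α)
Σ-nAt []      n _   = Σ≤-zero n (λ j → refl)
Σ-nAt (a ∷ α) n α≤n = begin
  Σ≤ n (λ j → δ a (suc j) + nAt (suc j) α)
    ≡⟨ Σ≤-+ n _ _ ⟩
  Σ≤ n (λ j → δ a (suc j)) + Σ≤ n (λ j → nAt (suc j) α)
    ≡⟨ cong₂ _+_ (Σ-at-entry a n (NP.≤-trans (NP.m≤m+n a (weight α)) α≤n))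
                 (Σ-nAt α n (NP.≤-trans (NP.m≤n+m (weight α) a) α≤n)) ⟩
  ι (isPos a) + ι (parts α)
    ≡⟨ ι-+ (isPos a) (parts α) ⟨
  ι (isPos a ℕ.+ parts α) ∎
  where open ≡-Reasoning

lhs-coef : ∀ n k (α : Vec ℕ m) →
  ((tS *S ∂t 𝓕) +S (oneMinusS *S ∂s 𝓕)) n k α
  ≡ δ (weight α) n * ((ι n - ι k) * δ (parts α) k + ι (suc k) * δ (parts α) (suc k))
lhs-coef n k α = begin
  (tS *S ∂t 𝓕) n k α + (oneMinusS *S ∂s 𝓕) n k α
    ≡⟨ cong₂ _+_ (t∂t-coef 𝓕 n k α) ([1-s]∂s-coef 𝓕 n k α) ⟩
  ι n * 𝓕 n k α + (ι (suc k) * 𝓕 n (suc k) α - ι k * 𝓕 n k α)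
    ≡⟨ cong₂ (λ u v → ι n * u + (ι (suc k) * v - ι k * u)) (𝓕-coef n k α) (𝓕-coef n (suc k) α) ⟩
  ι n * (D * K) + (ι (suc k) * (D * K′) - ι k * (D * K))
    ≡⟨ solve 6 (λ a b c D K K′ → a :* (D :* K) :+ (c :* (D :* K′) :- b :* (D :* K))
                                := D :* ((a :- b) :* K :+ c :* K′))
         refl (ι n) (ι k) (ι (suc k)) D K K′ ⟩
  D * ((ι n - ι k) * K + ι (suc k) * K′) ∎
  where
  open ≡-Reasoning
  D K K′ : ℚ
  D  = δ (weight α) n
  K  = δ (parts α) k
  K′ = δ (parts α) (suc k)

tP*-zero : ∀ (G : Ser m) k α → ((tS *S P) *S G) 0 k α ≡ 0ℚ
tP*-zero G k α = Σ≤-zero k (λ b → trans (*C-congˡ (t*-zero P b) α) (*C-zeroˡ _ α))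

tP*-suc : ∀ (G : Ser m) n k α → ((tS *S P) *S G) (suc n) k α ≡ Σ≤ n (λ j → (p (suc j) *C G (n ∸ j) k) α)
tP*-suc G n k α =
  trans (Σ≤-head n _)
  (trans (cong₂ _+_ (Σ≤-zero k (λ b → trans (*C-congˡ (t*-zero P b) α) (*C-zeroˡ _ α)))
                    (Σ≤-cong′ n only-s⁰))
  (QP.+-identityˡ _))
  where
  -- P has no positive powers of s
  only-s⁰ : ∀ j → Σ≤ k (λ b → ((tS *S P) (suc j) b *C G (n ∸ j) (k ∸ b)) α)
                  ≡ (p (suc j) *C G (n ∸ j) k) α
  only-s⁰ j = trans (Σ≤-first k (λ b → trans (*C-congˡ (t*-suc P j (suc b)) α) (*C-zeroˡ _ α)))
                    (*C-congˡ (t*-suc P j 0) α)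

rhs-coef : ∀ n k (α : Vec ℕ m) → let w = weight α; ℓ = parts α in
  ((tS *S P) *S 𝓕) n k α ≡ δ w n * ((ι w - ι ℓ) * δ ℓ k + ι ℓ * δ ℓ (suc k))
rhs-coef zero    k α =
  trans (tP*-zero 𝓕 k α) (sym (trans (δ-guard (weight α) 0 empty) (QP.*-zeroʳ (δ (weight α) 0))))
  where
  -- only the empty monomial has degree 0
  empty : weight α ≡ 0 →
    (ι (weight α) - ι (parts α)) * δ (parts α) k + ι (parts α) * δ (parts α) (suc k) ≡ 0ℚ
  empty w≡0 rewrite w≡0 | NP.n≤0⇒n≡0 (subst (parts α ≤_) w≡0 (parts≤weight α)) =
    trans (QP.+-identityʳ _) (QP.*-zeroˡ (δ 0 k))
rhs-coef (suc n) k α = begin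
  ((tS *S P) *S 𝓕) (suc n) k α
    ≡⟨ tP*-suc 𝓕 n k α ⟩
  Σ≤ n (λ j → (p (suc j) *C 𝓕 (n ∸ j) k) α)
    ≡⟨ Σ≤-cong n (λ j j≤n → trans (*C-congʳ (𝓕-coef (n ∸ j) k) α)
         (trans (p*shape j 0 0 (n ∸ j) k α) (cong (λ u → δ w u * T j) (degrees j≤n)))) ⟩
  Σ≤ n (λ j → D * T j)
    ≡⟨ trans (Σ≤-*ˡ n D T) (cong (D *_) (Σ≤-+ n _ _)) ⟩
  D * (Σ≤ n (λ j → nAbove (suc j) α * K) + Σ≤ n (λ j → nAt (suc j) α * K′))
    ≡⟨ cong₂ (λ u v → D * (u + v)) (Σ≤-*ʳ n K _) (Σ≤-*ʳ n K′ _) ⟩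
  D * (Σ≤ n (λ j → nAbove (suc j) α) * K + Σ≤ n (λ j → nAt (suc j) α) * K′)
    ≡⟨ δ-guard w (suc n) (λ w≡n+1 → let w≤n+1 = NP.≤-reflexive w≡n+1 in
         cong₂ (λ u v → u * K + v * K′)
           (x+y≡w⇒x≡w-y (Σ≤ n (λ j → nAbove (suc j) α)) (ι ℓ) (ι w) (Σ-nAbove α n w≤n+1))
           (Σ-nAt α n w≤n+1)) ⟩
  D * ((ι w - ι ℓ) * K + ι ℓ * K′) ∎
  where
  open ≡-Reasoning
  w ℓ : ℕ
  w = weight α
  ℓ = parts α
  D K K′ : ℚ
  D  = δ w (suc n)
  K  = δ ℓ k
  K′ = δ ℓ (suc k)
  T : ℕ → ℚ
  T j = nAbove (suc j) α * K + nAt (suc j) α * K′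
  degrees : ∀ {j} → j ≤ n → n ∸ j ℕ.+ suc j ≡ suc n
  degrees j≤n = trans (NP.+-suc _ _) (cong suc (NP.m∸n+n≡m j≤n))

-- The theorem: both sides have the coefficient [|α| = n](…), and under the
-- indicators |α| = n and ℓ(α) = k (resp. k + 1) the two brackets agree.
proposition7 : (m n k : ℕ) (α : Vec ℕ m) →
    ((tS *S ∂t 𝓕) +S (oneMinusS *S ∂s 𝓕)) n k α ≡ ((tS *S P) *S 𝓕) n k α
proposition7 m n k α = begin
  ((tS *S ∂t 𝓕) +S (oneMinusS *S ∂s 𝓕)) n k α
    ≡⟨ lhs-coef n k α ⟩
  δ w n * ((ι n - ι k) * δ ℓ k + ι (suc k) * δ ℓ (suc k))
    ≡⟨ δ-guard w n (λ w≡n → cong₂ _+_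
         (δ-guardʳ ℓ k (λ ℓ≡k → cong₂ (λ u v → ι u - ι v) (sym w≡n) (sym ℓ≡k)))
         (δ-guardʳ ℓ (suc k) (λ ℓ≡k+1 → cong ι (sym ℓ≡k+1)))) ⟩
  δ w n * ((ι w - ι ℓ) * δ ℓ k + ι ℓ * δ ℓ (suc k))
    ≡⟨ rhs-coef n k α ⟨
  ((tS *S P) *S 𝓕) n k α ∎
  where
  open ≡-Reasoning
  w ℓ : ℕ
  w = weight α
  ℓ = parts α
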